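{- Let $m,s,t,n$ be positive integers with $n\geq m\geq 3$. Then $$tn(m+s-2)+s\leq r(K_{m}, sF_{t,n})\leq (tn+1)(s-1)+r(K_{m},F_{t,n}).$$
   Context: For graphs $G,H$, the Ramsey number $r(G,H)$ is the least integer $r$ such that every red/blue edge-coloring of the complete graph $K_r$ contains a red copy of $G$ or a blue copy of $H$. The generalized fan $F_{t,n}$ is $K_1+nK_t$, the join of a single vertex with the disjoint union of $n$ copies of $K_t$. For a graph $G$ and positive integer $s$, $sG$ denotes the disjoint union of $s$ copies of $G$. -}

module Defs where

open import Data.Nat using (ℕ; zero; suc; _+_; _≤_)
open import Data.Fin using (Fin; splitAt; _≟_)
open import Data.Bool using (Bool; true; false; not)
open import Data.Sum using (inj₁; inj₂)
open import Data.Product using (_×_; Σ-syntax)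
open import Data.Sum using (_⊎_)
open import Relation.Nullary.Decidable using (⌊_⌋)
open import Relation.Binary.PropositionalEquality using (_≡_)
open import Function.Definitions using (Injective)

-- A (simple) graph on the vertex set Fin V, given by its adjacency function.
-- All graphs constructed below are symmetric and loopless.
record Graph : Set where
  field
    V   : ℕ
    adj : Fin V → Fin V → Bool
open Graph public

K : ℕ → Graph
K m = record { V = m ; adj = λ i j → not ⌊ i ≟ j ⌋ }

Empty : Graph
Empty = record { V = 0 ; adj = λ () }

_⊕_ : Graph → Graph → Graph
G ⊕ H = record { V = V G + V H ; adj = a }
  where
  a : Fin (V G + V H) → Fin (V G + V H) → Bool
  a i j with splitAt (V G) i | splitAt (V G) j
  ... | inj₁ x | inj₁ y = adj G x y
  ... | inj₂ x | inj₂ y = adj H x y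
  ... | inj₁ _ | inj₂ _ = false
  ... | inj₂ _ | inj₁ _ = false

copies : ℕ → Graph → Graph
copies zero    G = Empty
copies (suc s) G = G ⊕ copies s G

join1 : Graph → Graph
join1 G = record { V = suc (V G) ; adj = a }
  where
  a : Fin (suc (V G)) → Fin (suc (V G)) → Bool
  a Fin.zero    Fin.zero    = false
  a Fin.zero    (Fin.suc _) = true
  a (Fin.suc _) Fin.zero    = true
  a (Fin.suc x) (Fin.suc y) = adj G x y

Fan : ℕ → ℕ → Graph
Fan t n = join1 (copies n (K t))

-- red/blue edge-coloring of K_r : true = red, false = blue (symmetric;
-- the diagonal is irrelevant)
record Coloring (r : ℕ) : Set where
  field
    col : Fin r → Fin r → Bool
    sym : ∀ i j → col i j ≡ col j i
open Coloring public

HasCopy : ∀ {r} → Coloring r → Bool → Graph → Set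
HasCopy {r} c b G =
  Σ[ f ∈ (Fin (V G) → Fin r) ]
    (Injective _≡_ _≡_ f × (∀ i j → adj G i j ≡ true → col c (f i) (f j) ≡ b))

Arrows : ℕ → Graph → Graph → Set
Arrows r G H = (c : Coloring r) → HasCopy c true G ⊎ HasCopy c false H

IsRamseyNumber : Graph → Graph → ℕ → Set
IsRamseyNumber G H R = Arrows R G H × (∀ r → Arrows r G H → R ≤ r)

-- Lower bound: label the vertices of K_N by m − 1 labels and colour an edge blue iff its ends
-- share a label, so there is no red K_m. Use m − 2 classes of size tn and one of size
-- s(tn + 1) − 1. A blue fan lies inside one class, because its centre is joined to all its
-- other vertices, and it has tn + 1 vertices; so a blue s F_{t,n} lies in the last class, which
-- is one vertex too small. Only the cone shape K_1 + G of the fan matters here.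
-- Upper bound: take a blue F_{t,n}, delete its tn + 1 vertices and recurse on the rest;
-- r(K_m, F_{t,n}) vertices remain for the last copy.
module Submission where

open import Defs
open import Data.Bool using (true; false; not)
open import Data.Empty using (⊥-elim)
open import Data.Fin as Fin using (Fin; zero; suc; splitAt; _↑ˡ_; _↑ʳ_; punchIn; punchOut; inject≤)
open import Data.Fin.Properties as Finₚ using (+↔⊎; *↔×; injective⇒≤)
open import Data.Nat using (ℕ; zero; suc; _+_; _*_; _∸_; _≤_; _<_; _≤?_; s≤s)
open import Data.Nat.Properties using (≰⇒>; ≤-trans; m≤n+m; 1+n≰n; +-assoc; +-comm; *-comm)
open import Data.Nat.Tactic.RingSolver using (solve-∀)
open import Data.Product using (_×_; Σ-syntax; _,_; proj₁; proj₂)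
open import Data.Sum using (_⊎_; inj₁; inj₂; [_,_]′)
open import Data.Sum.Function.Propositional using (_⊎-↔_)
open import Function using (_∘_)
open import Function.Bundles using (_↔_; Inverse; Injection)
open import Function.Definitions using (Injective)
open import Function.Properties.Inverse using (↔-trans; ↔-refl; ↔⇒↣)
open import Relation.Nullary using (¬_; yes; no)
open import Relation.Nullary.Decidable using (⌊_⌋)
open import Relation.Binary.PropositionalEquality using (_≡_; _≢_; refl; trans; cong; subst) renaming (sym to ≡-sym)

Embedding : Graph → Graph → Set
Embedding G H =
  Σ[ φ ∈ (Fin (V G) → Fin (V H)) ]
    (Injective _≡_ _≡_ φ × (∀ i j → adj G i j ≡ true → adj H (φ i) (φ j) ≡ true))

HasCopy-∘ : ∀ {r} {c : Coloring r} {b G H} → Embedding G H → HasCopy c b H → HasCopy c b G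
HasCopy-∘ (φ , φ-inj , φ-hom) (f , f-inj , f-hom) =
  f ∘ φ , φ-inj ∘ f-inj , λ i j e → f-hom (φ i) (φ j) (φ-hom i j e)

restrict : ∀ {p N} → Coloring N → (Fin p → Fin N) → Coloring p
restrict c e = record { col = λ i j → col c (e i) (e j) ; sym = λ i j → sym c (e i) (e j) }

HasCopy-restrict : ∀ {p N} (c : Coloring N) {e : Fin p → Fin N} → Injective _≡_ _≡_ e →
  ∀ {b G} → HasCopy (restrict c e) b G → HasCopy c b G
HasCopy-restrict c {e} e-inj (f , f-inj , f-hom) = e ∘ f , f-inj ∘ e-inj , f-hom

Arrows-mono : ∀ {p N G H} → p ≤ N → Arrows p G H → Arrows N G H
Arrows-mono p≤N arrows c with arrows (restrict c (λ i → inject≤ i p≤N))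
... | inj₁ red  = inj₁ (HasCopy-restrict c (Finₚ.inject≤-injective p≤N p≤N _ _) red)
... | inj₂ blue = inj₂ (HasCopy-restrict c (Finₚ.inject≤-injective p≤N p≤N _ _) blue)

V-copies : ∀ s G → V (copies s G) ≡ s * V G
V-copies zero    G = refl
V-copies (suc s) G = cong (V G +_) (V-copies s G)

splitAt-injective : ∀ m {n} → Injective _≡_ _≡_ (splitAt m {n})
splitAt-injective m = Injection.injective (↔⇒↣ (+↔⊎ {m}))

↑ˡ-embedding : ∀ G H → Embedding G (G ⊕ H)
↑ˡ-embedding G H = (_↑ˡ V H) , Finₚ.↑ˡ-injective (V H) _ _ , hom
  where
  hom : ∀ i j → adj G i j ≡ true → adj (G ⊕ H) (i ↑ˡ V H) (j ↑ˡ V H) ≡ true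
  hom i j e rewrite Finₚ.splitAt-↑ˡ (V G) i (V H) | Finₚ.splitAt-↑ˡ (V G) j (V H) = e

↑ʳ-embedding : ∀ G H → Embedding H (G ⊕ H)
↑ʳ-embedding G H = (V G ↑ʳ_) , Finₚ.↑ʳ-injective (V G) _ _ , hom
  where
  hom : ∀ i j → adj H i j ≡ true → adj (G ⊕ H) (V G ↑ʳ i) (V G ↑ʳ j) ≡ true
  hom i j e rewrite Finₚ.splitAt-↑ʳ (V G) (V H) i | Finₚ.splitAt-↑ʳ (V G) (V H) j = e

embedding-∘ : ∀ {G H J} → Embedding H J → Embedding G H → Embedding G J
embedding-∘ (ψ , ψ-inj , ψ-hom) (φ , φ-inj , φ-hom) =
  ψ ∘ φ , φ-inj ∘ ψ-inj , λ i j e → ψ-hom (φ i) (φ j) (φ-hom i j e)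

copies-cover : ∀ s G (i : Fin (V (copies s G))) →
  Σ[ φ ∈ Embedding G (copies s G) ] Σ[ j ∈ Fin (V G) ] proj₁ φ j ≡ i
copies-cover (suc s) G i with splitAt (V G) i in eq
... | inj₁ j = ↑ˡ-embedding G (copies s G) , j ,
  splitAt-injective (V G) (trans (Finₚ.splitAt-↑ˡ (V G) j _) (≡-sym eq))
... | inj₂ i′ with copies-cover s G i′
...   | φ , j , refl = embedding-∘ {J = copies (suc s) G} (↑ʳ-embedding G (copies s G)) φ , j ,
  splitAt-injective (V G) (trans (Finₚ.splitAt-↑ʳ (V G) _ (proj₁ φ j)) (≡-sym eq))

[,]-injective : ∀ {A B C : Set} {f : A → C} {g : B → C} →
  Injective _≡_ _≡_ f → Injective _≡_ _≡_ g → (∀ a b → g b ≢ f a) → Injective _≡_ _≡_ [ f , g ]′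
[,]-injective f-inj g-inj disjoint {inj₁ a} {inj₁ a′} e = cong inj₁ (f-inj e)
[,]-injective f-inj g-inj disjoint {inj₂ b} {inj₂ b′} e = cong inj₂ (g-inj e)
[,]-injective f-inj g-inj disjoint {inj₁ a} {inj₂ b}  e = ⊥-elim (disjoint a b (≡-sym e))
[,]-injective f-inj g-inj disjoint {inj₂ b} {inj₁ a}  e = ⊥-elim (disjoint a b e)

HasCopy-⊕ : ∀ {N} {c : Coloring N} {b G H} → ((f , _) : HasCopy c b G) → ((g , _) : HasCopy c b H) →
  (∀ i j → g j ≢ f i) → HasCopy c b (G ⊕ H)
HasCopy-⊕ {c = c} {b} {G} {H} (f , f-inj , f-hom) (g , g-inj , g-hom) disjoint =
  [ f , g ]′ ∘ splitAt (V G) ,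
  splitAt-injective (V G) ∘ [,]-injective f-inj g-inj disjoint ,
  hom
  where
  hom : ∀ i j → adj (G ⊕ H) i j ≡ true →
    col c ([ f , g ]′ (splitAt (V G) i)) ([ f , g ]′ (splitAt (V G) j)) ≡ b
  hom i j with splitAt (V G) i | splitAt (V G) j
  ... | inj₁ x | inj₁ y = f-hom x y
  ... | inj₂ x | inj₂ y = g-hom x y
  ... | inj₁ _ | inj₂ _ = λ ()
  ... | inj₂ _ | inj₁ _ = λ ()

HasCopy-Empty : ∀ {N} {c : Coloring N} {b} → HasCopy c b Empty
HasCopy-Empty = (λ ()) , (λ {}) , (λ ())

-- Removing g 0 and closing the gap with punchOut shrinks the problem by one vertex;
-- punchIn then re-inserts the gap into the complement found recursively.
complement : ∀ p q (g : Fin p → Fin (p + q)) → Injective _≡_ _≡_ g →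
  Σ[ e ∈ (Fin q → Fin (p + q)) ] (Injective _≡_ _≡_ e × (∀ i j → e j ≢ g i))
complement zero    q g g-inj = (λ j → j) , (λ e → e) , (λ ())
complement (suc p) q g g-inj = punchIn v ∘ e , e-inj ∘ Finₚ.punchIn-injective v _ _ , disjoint
  where
  v = g zero
  v≢g-suc : ∀ i → v ≢ g (suc i)
  v≢g-suc i e with () ← g-inj e
  g′ : Fin p → Fin (p + q)
  g′ i = punchOut (v≢g-suc i)
  g′-inj : Injective _≡_ _≡_ g′
  g′-inj e = Finₚ.suc-injective (g-inj (Finₚ.punchOut-injective (v≢g-suc _) (v≢g-suc _) e))
  rest = complement p q g′ g′-inj
  e = proj₁ rest
  e-inj = proj₁ (proj₂ rest)
  disjoint : ∀ i j → punchIn v (e j) ≢ g i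
  disjoint zero    j = Finₚ.punchInᵢ≢i v (e j)
  disjoint (suc i) j eq = proj₂ (proj₂ rest) i j
    (Finₚ.punchIn-injective v _ _ (trans eq (≡-sym (Finₚ.punchIn-punchOut (v≢g-suc i)))))

Arrows-⊕ : ∀ {R N G H H′} → Arrows R G H → R ≤ V H + N → Arrows N G H′ → Arrows (V H + N) G (H ⊕ H′)
Arrows-⊕ {N = N} {H = H} arrows R≤ arrows′ c with Arrows-mono R≤ arrows c
... | inj₁ red = inj₁ red
... | inj₂ blue@(g , g-inj , _) with complement (V H) N g g-inj
...   | e , e-inj , disjoint with arrows′ (restrict c e)
...     | inj₁ red′  = inj₁ (HasCopy-restrict c e-inj red′)
...     | inj₂ blue′ =
  inj₂ (HasCopy-⊕ {c = c} blue (HasCopy-restrict c e-inj blue′) λ i j → disjoint i (proj₁ blue′ j))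

Arrows-copies : ∀ {R G H} → Arrows R G H → ∀ k → Arrows (k * V H + R) G (copies (suc k) H)
Arrows-copies arrows zero c with arrows c
... | inj₁ red  = inj₁ red
... | inj₂ blue = inj₂ (HasCopy-⊕ {c = c} blue (HasCopy-Empty {c = c}) λ _ ())
Arrows-copies {R} {G} {H} arrows (suc k) =
  subst (λ N → Arrows N G (copies (suc (suc k)) H)) (≡-sym (+-assoc (V H) (k * V H) R))
    (Arrows-⊕ arrows (≤-trans (m≤n+m R (k * V H)) (m≤n+m _ (V H))) (Arrows-copies arrows k))

AtMost : {A : Set} → ℕ → (A → Set) → Set
AtMost {A} b P =
  Σ[ pos ∈ (∀ x → P x → Fin b) ] (∀ {x y} px py → pos x px ≡ pos y py → x ≡ y)

AtMost-preimage : ∀ {A B : Set} {f : A → B} {b P} → Injective _≡_ _≡_ f → AtMost b P → AtMost b (P ∘ f)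
AtMost-preimage {f = f} f-inj (pos , pos-inj) = (pos ∘ f) , λ px py → f-inj ∘ pos-inj px py

AtMost⇒≤ : ∀ {A : Set} {a b P} → AtMost b P →
  (f : Fin a → A) → Injective _≡_ _≡_ f → (∀ x → P (f x)) → a ≤ b
AtMost⇒≤ (pos , pos-inj) f f-inj Pf = injective⇒≤ (f-inj ∘ pos-inj (Pf _) (Pf _))

K-adj : ∀ {m} {x y : Fin m} → x ≢ y → adj (K m) x y ≡ true
K-adj {x = x} {y} x≢y with x Fin.≟ y
... | yes x≡y = ⊥-elim (x≢y x≡y)
... | no _    = refl

module _ {N p : ℕ} (ℓ : Fin N → Fin p) where

  labelColoring : Coloring N
  labelColoring = record { col = λ u v → not ⌊ ℓ u Fin.≟ ℓ v ⌋ ; sym = symmetric }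
    where
    symmetric : ∀ u v → not ⌊ ℓ u Fin.≟ ℓ v ⌋ ≡ not ⌊ ℓ v Fin.≟ ℓ u ⌋
    symmetric u v with ℓ u Fin.≟ ℓ v | ℓ v Fin.≟ ℓ u
    ... | yes _  | yes _  = refl
    ... | no _   | no _   = refl
    ... | yes eq | no ne  = ⊥-elim (ne (≡-sym eq))
    ... | no ne  | yes eq = ⊥-elim (ne (≡-sym eq))

  blue⇒sameLabel : ∀ u v → col labelColoring u v ≡ false → ℓ u ≡ ℓ v
  blue⇒sameLabel u v blue with ℓ u Fin.≟ ℓ v
  blue⇒sameLabel u v _  | yes eq = eq
  blue⇒sameLabel u v () | no _

  red⇒differentLabels : ∀ u v → col labelColoring u v ≡ true → ℓ u ≢ ℓ v
  red⇒differentLabels u v red with ℓ u Fin.≟ ℓ v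
  red⇒differentLabels u v () | yes _
  red⇒differentLabels u v _  | no ne = ne

  labelColoring-noRedClique : ¬ HasCopy labelColoring true (K (suc p))
  labelColoring-noRedClique (f , _ , f-hom) = 1+n≰n (injective⇒≤ ℓ∘f-inj)
    where
    ℓ∘f-inj : Injective _≡_ _≡_ (ℓ ∘ f)
    ℓ∘f-inj {x} {y} eq with x Fin.≟ y
    ... | yes x≡y = x≡y
    ... | no x≢y  = ⊥-elim (red⇒differentLabels (f x) (f y) (f-hom x y (K-adj x≢y)) eq)

  blueCone-sameLabel : ∀ {G} ((f , _) : HasCopy labelColoring false (join1 G)) →
    ∀ a → ℓ (f a) ≡ ℓ (f zero)
  blueCone-sameLabel (f , _ , f-hom) zero    = refl
  blueCone-sameLabel (f , _ , f-hom) (suc a) =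
    ≡-sym (blue⇒sameLabel (f zero) (f (suc a)) (f-hom zero (suc a) refl))

module _ {N p G} (ℓ : Fin N → Fin (suc p)) (small : ∀ q → AtMost (V G) (λ v → ℓ v ≡ suc q)) where

  blueCone-labelZero : ((f , _) : HasCopy (labelColoring ℓ) false (join1 G)) → ∀ a → ℓ (f a) ≡ zero
  blueCone-labelZero cone@(f , f-inj , _) a with ℓ (f zero) in eq
  ... | zero  = trans (blueCone-sameLabel ℓ cone a) eq
  ... | suc q =
    ⊥-elim (1+n≰n (AtMost⇒≤ (small q) f f-inj λ b → trans (blueCone-sameLabel ℓ cone b) eq))

  blueCones-≤ : ∀ {s b} → AtMost b (λ v → ℓ v ≡ zero) →
    HasCopy (labelColoring ℓ) false (copies s (join1 G)) → V (copies s (join1 G)) ≤ b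
  blueCones-≤ {s} big blue@(h , h-inj , _) = AtMost⇒≤ big h h-inj labelZero
    where
    labelZero : ∀ i → ℓ (h i) ≡ zero
    labelZero i with copies-cover s (join1 G) i
    ... | φ , j , refl = blueCone-labelZero (HasCopy-∘ {c = labelColoring ℓ} φ blue) j

module _ {p T B : ℕ} where

  blocks : Fin (p * T + B) ↔ (Fin p × Fin T ⊎ Fin B)
  blocks = ↔-trans +↔⊎ (*↔× ⊎-↔ ↔-refl)

  blockLabel : Fin p × Fin T ⊎ Fin B → Fin (suc p)
  blockLabel (inj₁ (q , _)) = suc q
  blockLabel (inj₂ _)       = zero

  smallBlock-atMost : ∀ q → AtMost T (λ x → blockLabel x ≡ suc q)
  smallBlock-atMost q = pos , pos-inj
    where
    pos : ∀ x → blockLabel x ≡ suc q → Fin T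
    pos (inj₁ (_ , r)) _ = r
    pos (inj₂ _)       ()
    pos-inj : ∀ {x y} px py → pos x px ≡ pos y py → x ≡ y
    pos-inj {inj₁ _} {inj₁ _} refl refl refl = refl
    pos-inj {inj₂ _} () _
    pos-inj {inj₁ _} {inj₂ _} _ ()

  bigBlock-atMost : AtMost B (λ x → blockLabel x ≡ zero)
  bigBlock-atMost = pos , pos-inj
    where
    pos : ∀ x → blockLabel x ≡ zero → Fin B
    pos (inj₁ _) ()
    pos (inj₂ y) _ = y
    pos-inj : ∀ {x y} px py → pos x px ≡ pos y py → x ≡ y
    pos-inj {inj₂ _} {inj₂ _} refl refl refl = refl
    pos-inj {inj₁ _} () _
    pos-inj {inj₂ _} {inj₁ _} _ ()

cones-notArrows : ∀ p k G →
  ¬ Arrows (p * V G + (k * suc (V G) + V G)) (K (suc (suc p))) (copies (suc k) (join1 G))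
cones-notArrows p k G arrows = [ labelColoring-noRedClique ℓ , noBlue ]′ (arrows (labelColoring ℓ))
  where
  T = V G
  B = k * suc T + T
  decode : Fin (p * T + B) → Fin p × Fin T ⊎ Fin B
  decode = Inverse.to (blocks {p} {T} {B})
  decode-inj : Injective _≡_ _≡_ decode
  decode-inj = Injection.injective (↔⇒↣ blocks)
  ℓ = blockLabel ∘ decode
  |sF| : V (copies (suc k) (join1 G)) ≡ suc B
  |sF| = trans (V-copies (suc k) (join1 G)) (cong suc (+-comm T (k * suc T)))
  noBlue : ¬ HasCopy (labelColoring ℓ) false (copies (suc k) (join1 G))
  noBlue blue = 1+n≰n (subst (_≤ B) |sF|
    (blueCones-≤ {G = G} ℓ (λ q → AtMost-preimage decode-inj (smallBlock-atMost q)) {s = suc k}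
       (AtMost-preimage decode-inj bigBlock-atMost) blue))

cones-lowerBound : ∀ p k G {N} → Arrows N (K (suc (suc p))) (copies (suc k) (join1 G)) →
  p * V G + (k * suc (V G) + V G) < N
cones-lowerBound p k G {N} arrows with N ≤? p * V G + (k * suc (V G) + V G)
... | yes N≤ = ⊥-elim (cones-notArrows p k G (Arrows-mono N≤ arrows))
... | no N≰  = ≰⇒> N≰

theorem1p7 : (m s t n : ℕ) → 1 ≤ s → 1 ≤ t → 3 ≤ m → m ≤ n →
    (R R₁ : ℕ) →
    IsRamseyNumber (K m) (copies s (Fan t n)) R →
    IsRamseyNumber (K m) (Fan t n) R₁ →
    (t * n * (m + s ∸ 2) + s ≤ R) × (R ≤ (t * n + 1) * (s ∸ 1) + R₁)
theorem1p7 (suc (suc p)) (suc k) t n (s≤s _) _ (s≤s (s≤s _)) _ R R₁ (arrows , minimal) (arrows₁ , _) =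
  lower , upper
  where
  G = copies n (K t)
  |G| : V G ≡ t * n
  |G| = trans (V-copies n (K t)) (*-comm n t)
  lower-shape : ∀ T p k → suc (p * T + (k * suc T + T)) ≡ T * (p + suc k) + suc k
  lower-shape = solve-∀
  upper-shape : ∀ T k R₁ → k * suc T + R₁ ≡ (T + 1) * k + R₁
  upper-shape = solve-∀
  lower : t * n * (p + suc k) + suc k ≤ R
  lower = subst (_≤ R)
    (trans (cong (λ T → suc (p * T + (k * suc T + T))) |G|) (lower-shape (t * n) p k))
    (cones-lowerBound p k G arrows)
  upper : R ≤ (t * n + 1) * k + R₁
  upper = minimal _ (subst (λ N → Arrows N (K (suc (suc p))) (copies (suc k) (Fan t n)))
    (trans (cong (λ T → k * suc T + R₁) |G|) (upper-shape (t * n) k R₁))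
    (Arrows-copies arrows₁ k))
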